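{- Let $U=(X,B)$ be an abstract unital of order $n$, $k\ge 3$ an integer and $b_1,\dots,b_k$ pairwise distinct blocks of $U$. Then: (i) If $b_3\subseteq F_U(b_1,b_2)$, then $b_1$ and $b_2$ are disjoint. (ii) If $b_3\subseteq F_U(b_1,b_2)$, then $b_1\subseteq F_U(b_2,b_3)$ and $b_2\subseteq F_U(b_1,b_3)$. (iii) If $b_3\cup b_4\subseteq F_U(b_1,b_2)$, then $b_3$ and $b_4$ are disjoint. (iv) The blocks $b_1,\dots,b_k$ form an embedded dual $k$-net in $U$ if and only if $b_3\cup\dots\cup b_k\subseteq F_U(b_1,b_2)$.
   Context: An abstract unital of order $n$ is a $2$-$(n^3+1,n+1,1)$ design $(X,B)$. For blocks $b_1,b_2$, a point $P\in X$ is a full point with respect to $(b_1,b_2)$ if $P\notin b_1\cup b_2$ and for every $Q\in b_1$ the block through $P$ and $Q$ intersects $b_2$; $F_U(b_1,b_2)$ is the set of such points. For an integer $k\ge3$, blocks $b_1,\dots,b_k$ form an embedded dual $k$-net in $U$ if for all $1\le i<j\le k$: $b_i\cap b_j=\emptyset$, and for all $P\in b_i$, $Q\in b_j$ the block containing $P$ and $Q$ intersects each of $b_1,\dots,b_k$ in a point. -}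

module Defs where

open import Data.Nat using (ℕ; suc; _^_; _≤_)
open import Data.Fin using (Fin; toℕ)
open import Data.Fin.Subset using (Subset; _∈_; _∉_; ∣_∣)
open import Data.Product using (Σ; _×_; _,_; ∃)
open import Relation.Binary.PropositionalEquality using (_≡_; _≢_)
open import Function.Definitions using (Injective)
open import Level using (0ℓ)

-- Points are Fin (n^3+1); the (finitely many) blocks are indexed by
-- Fin nBlocks, each block being a subset of points; distinct indices
-- give distinct blocks (B is a set of blocks).
record AbstractUnital (n : ℕ) : Set where
  field
    nBlocks      : ℕ
    block        : Fin nBlocks → Subset (suc (n ^ 3))
    block-inj    : Injective _≡_ _≡_ block
    block-size   : ∀ b → ∣ block b ∣ ≡ suc n
    two-design   : ∀ (P Q : Fin (suc (n ^ 3))) → P ≢ Q →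
                   Σ (Fin nBlocks) λ b → (P ∈ block b × Q ∈ block b) ×
                     (∀ c → P ∈ block c → Q ∈ block c → c ≡ b)

module _ {n : ℕ} (U : AbstractUnital n) where
  open AbstractUnital U

  Point : Set
  Point = Fin (suc (n ^ 3))

  Block : Set
  Block = Fin nBlocks

  _on_ : Point → Block → Set
  P on b = P ∈ block b

  Meets : Block → Block → Set
  Meets b c = ∃ λ R → R on b × R on c

  MeetsInOnePoint : Block → Block → Set
  MeetsInOnePoint b c = Σ Point λ R → (R on b × R on c) ×
                          (∀ S → S on b → S on c → S ≡ R)

  Disjoint : Block → Block → Set
  Disjoint b c = ∀ R → R on b → R on c → Data.Empty.⊥
    where import Data.Empty

  -- P ∈ F_U(b₁,b₂): P ∉ b₁ ∪ b₂ and for every Q ∈ b₁ the block through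
  -- P and Q (unique by the design axiom) meets b₂.
  FullPoint : Block → Block → Point → Set
  FullPoint b₁ b₂ P =
    (P on b₁ → Data.Empty.⊥) × (P on b₂ → Data.Empty.⊥) ×
    (∀ Q → Q on b₁ → ∀ c → P on c → Q on c → Meets c b₂)
    where import Data.Empty

  _⊆F[_,_] : Block → Block → Block → Set
  b ⊆F[ b₁ , b₂ ] = ∀ P → P on b → FullPoint b₁ b₂ P

  EmbeddedDualNet : (k : ℕ) → (Fin k → Block) → Set
  EmbeddedDualNet k bs =
    ∀ (i j : Fin k) → toℕ i Data.Nat.< toℕ j →
      Disjoint (bs i) (bs j) ×
      (∀ P Q → P on bs i → Q on bs j →
         ∀ c → P on c → Q on c → ∀ l → MeetsInOnePoint c (bs l))
    where import Data.Nat

-- Call X a perspective centre for blocks a, c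
-- (X on neither) if every block through X and a point of a also meets c. Sending
-- P ∈ a to the point where the block XP meets c is injective, and blocks have equal
-- size, so it is onto: X is then also a perspective centre for c, a. Hence being a
-- full point is symmetric in the two blocks, and perspectivities from one centre
-- compose. If a ⊆ F(b,c) while b and c share a point R, project a onto c from a point
-- Q ∈ b ∖ c: the block through Q and R is b itself, so b would meet a, which is
-- impossible. Rotating and swapping the blocks of a full triple and composing
-- perspectivities then make every three of b₁, …, b_k a full triple as soon as each
-- b_l (l ≥ 3) lies in F(b₁,b₂), and that is the dual net condition.
module Submission where

open import Defs
open import Data.Nat using (ℕ; zero; suc; _≤_; _<_; z≤n; s≤s)
open import Data.Nat.Properties using (≤-trans; <-≤-trans; <-irrefl)
open import Data.Fin using (Fin; zero; suc; toℕ; _≟_)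
open import Data.Fin.Properties using (any?; suc-injective; toℕ-injective)
open import Data.Fin.Subset using (Subset; _∈_; _∉_; _⊆_; ∣_∣; _-_; ⁅_⁆; inside; outside)
open import Data.Fin.Subset.Properties
  using (_∈?_; ⊆-antisym; x∈p∧x≢y⇒x∈p-y; p─q⊆p; x∈p⇒∣p-x∣<∣p∣)
open import Data.Vec.Base using ([]; _∷_; here; there)
open import Data.Product using (_×_; _,_; proj₁; proj₂; ∃)
open import Data.Empty using (⊥; ⊥-elim)
open import Relation.Nullary using (Dec; yes; no; ¬_; ¬?; _×-dec_)
open import Relation.Binary.Definitions using (DecidableEquality)
open import Relation.Binary.PropositionalEquality using (_≡_; _≢_; refl; sym; trans; cong; subst; ≢-sym)
open import Function.Definitions using (Injective)
open import Function.Bundles using (_⇔_; mk⇔)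

∣p∣≤∣q∣-by-injection : ∀ {N M} {p : Subset N} {q : Subset M} (R : Fin N → Fin M → Set) →
  (∀ {x} → x ∈ p → ∃ λ y → y ∈ q × R x y) →
  (∀ {x x′ y} → x ∈ p → x′ ∈ p → y ∈ q → R x y → R x′ y → x ≡ x′) →
  ∣ p ∣ ≤ ∣ q ∣
∣p∣≤∣q∣-by-injection {p = []} R image injective = z≤n
∣p∣≤∣q∣-by-injection {p = outside ∷ p} R image injective =
  ∣p∣≤∣q∣-by-injection (λ x → R (suc x)) (λ x∈p → image (there x∈p))
    (λ x∈p x′∈p y∈q r r′ → suc-injective (injective (there x∈p) (there x′∈p) y∈q r r′))
∣p∣≤∣q∣-by-injection {p = inside ∷ p} {q} R image injective with image here
... | y₀ , y₀∈q , r₀ =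
  ≤-trans (s≤s (∣p∣≤∣q∣-by-injection (λ x → R (suc x)) image′ injective′)) (x∈p⇒∣p-x∣<∣p∣ y₀∈q)
  where
  image′ : ∀ {x} → x ∈ p → ∃ λ y → y ∈ q - y₀ × R (suc x) y
  image′ x∈p with image (there x∈p)
  ... | y , y∈q , r = y , x∈p∧x≢y⇒x∈p-y y∈q y≢y₀ , r
    where
    y≢y₀ : y ≢ y₀
    y≢y₀ refl with injective here (there x∈p) y₀∈q r₀ r
    ... | ()
  injective′ : ∀ {x x′ y} → x ∈ p → x′ ∈ p → y ∈ q - y₀ → R (suc x) y → R (suc x′) y → x ≡ x′
  injective′ x∈p x′∈p y∈q-y₀ r r′ =
    suc-injective (injective (there x∈p) (there x′∈p) (p─q⊆p q ⁅ y₀ ⁆ y∈q-y₀) r r′)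

∣p∣<∣q∣-by-injection : ∀ {N M} {p : Subset N} {q : Subset M} (R : Fin N → Fin M → Set) →
  (∀ {x} → x ∈ p → ∃ λ y → y ∈ q × R x y) →
  (∀ {x x′ y} → x ∈ p → x′ ∈ p → y ∈ q → R x y → R x′ y → x ≡ x′) →
  ∀ {y} → y ∈ q → (∀ {x} → x ∈ p → ¬ R x y) →
  ∣ p ∣ < ∣ q ∣
∣p∣<∣q∣-by-injection {p = p} {q} R image injective {y} y∈q missed =
  ≤-trans (s≤s (∣p∣≤∣q∣-by-injection R image′ injective′)) (x∈p⇒∣p-x∣<∣p∣ y∈q)
  where
  image′ : ∀ {x} → x ∈ p → ∃ λ y′ → y′ ∈ q - y × R x y′
  image′ x∈p with image x∈p
  ... | y′ , y′∈q , r = y′ , x∈p∧x≢y⇒x∈p-y y′∈q (λ { refl → missed x∈p r }) , r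
  injective′ : ∀ {x x′ y′} → x ∈ p → x′ ∈ p → y′ ∈ q - y → R x y′ → R x′ y′ → x ≡ x′
  injective′ x∈p x′∈p y′∈q-y = injective x∈p x′∈p (p─q⊆p q ⁅ y ⁆ y′∈q-y)

avoid-two : ∀ {A : Set} → DecidableEquality A → ∀ {a b c : A} → a ≢ b → b ≢ c → a ≢ c →
  ∀ i j → ∃ λ z → z ≢ i × z ≢ j
avoid-two _≟_ {a} {b} {c} a≢b b≢c a≢c i j with a ≟ i | a ≟ j | b ≟ i | b ≟ j
... | no a≢i | no a≢j | _        | _        = a , a≢i , a≢j
... | _      | _      | no b≢i   | no b≢j   = b , b≢i , b≢j
... | yes refl | _    | yes refl | _        = ⊥-elim (a≢b refl)
... | yes refl | _    | no _     | yes refl = c , ≢-sym a≢c , ≢-sym b≢c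
... | no _   | yes refl | yes refl | _      = c , ≢-sym b≢c , ≢-sym a≢c
... | no _   | yes refl | no _   | yes refl = ⊥-elim (a≢b refl)

module FullPoints {n : ℕ} (U : AbstractUnital n) where
  open AbstractUnital U

  Collinear : Point U → Point U → Point U → Set
  Collinear P Q R = ∃ λ d → P ∈ block d × Q ∈ block d × R ∈ block d

  Perspective : Point U → Block U → Block U → Set
  Perspective X a c = ∀ Q → Q ∈ block a → ∀ d → X ∈ block d → Q ∈ block d → Meets U d c

  joining-block : ∀ {P Q} → P ≢ Q → ∃ λ d → P ∈ block d × Q ∈ block d
  joining-block {P} {Q} P≢Q with two-design P Q P≢Q
  ... | d , (P∈d , Q∈d) , _ = d , P∈d , Q∈d

  joining-block-unique : ∀ {P Q c d} → P ≢ Q →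
    P ∈ block c → Q ∈ block c → P ∈ block d → Q ∈ block d → c ≡ d
  joining-block-unique {P} {Q} {c} {d} P≢Q P∈c Q∈c P∈d Q∈d with two-design P Q P≢Q
  ... | _ , _ , unique = trans (unique c P∈c Q∈c) (sym (unique d P∈d Q∈d))

  meets? : ∀ c d → Dec (Meets U c d)
  meets? c d = any? (λ R → R ∈? block c ×-dec R ∈? block d)

  meetsInOnePoint : ∀ {c d} → c ≢ d → Meets U c d → MeetsInOnePoint U c d
  meetsInOnePoint {c} {d} c≢d (R , R∈c , R∈d) = R , (R∈c , R∈d) , unique
    where
    unique : ∀ S → S ∈ block c → S ∈ block d → S ≡ R
    unique S S∈c S∈d with S ≟ R
    ... | yes S≡R = S≡R
    ... | no S≢R = ⊥-elim (c≢d (joining-block-unique S≢R S∈c R∈c S∈d R∈d))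

  ∈-∉⇒≢ : ∀ {P Q b} → P ∈ block b → Q ∉ block b → P ≢ Q
  ∈-∉⇒≢ P∈b Q∉b refl = Q∉b P∈b

  perspective-sym : ∀ {X a c} → X ∉ block a → X ∉ block c →
    Perspective X a c → Perspective X c a
  perspective-sym {X} {a} {c} X∉a X∉c persp S S∈c d X∈d S∈d with meets? d a
  ... | yes d-meets-a = d-meets-a
  ... | no d-misses-a = ⊥-elim (<-irrefl ∣a∣≡∣c∣
        (∣p∣<∣q∣-by-injection (Collinear X) image injective S∈c missed))
    where
    ∣a∣≡∣c∣ : ∣ block a ∣ ≡ ∣ block c ∣
    ∣a∣≡∣c∣ = trans (block-size a) (sym (block-size c))

    image : ∀ {P} → P ∈ block a → ∃ λ S′ → S′ ∈ block c × Collinear X P S′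
    image P∈a with joining-block (≢-sym (∈-∉⇒≢ P∈a X∉a))
    ... | e , X∈e , P∈e with persp _ P∈a e X∈e P∈e
    ...   | S′ , S′∈e , S′∈c = S′ , S′∈c , e , X∈e , P∈e , S′∈e

    injective : ∀ {P P′ S′} → P ∈ block a → P′ ∈ block a → S′ ∈ block c →
      Collinear X P S′ → Collinear X P′ S′ → P ≡ P′
    injective {P} {P′} P∈a P′∈a S′∈c (e , X∈e , P∈e , S′∈e) (e′ , X∈e′ , P′∈e′ , S′∈e′)
      with P ≟ P′
    ... | yes P≡P′ = P≡P′
    ... | no P≢P′ = ⊥-elim (X∉a (subst (λ f → X ∈ block f) e≡a X∈e))
      where
      e≡e′ : e ≡ e′
      e≡e′ = joining-block-unique (≢-sym (∈-∉⇒≢ S′∈c X∉c)) X∈e S′∈e X∈e′ S′∈e′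
      e≡a : e ≡ a
      e≡a = joining-block-unique P≢P′ P∈e (subst (λ f → P′ ∈ block f) (sym e≡e′) P′∈e′) P∈a P′∈a

    missed : ∀ {P} → P ∈ block a → ¬ Collinear X P S
    missed P∈a (e , X∈e , P∈e , S∈e) = d-misses-a (_ , subst (λ f → _ ∈ block f) e≡d P∈e , P∈a)
      where
      e≡d : e ≡ d
      e≡d = joining-block-unique (≢-sym (∈-∉⇒≢ S∈c X∉c)) X∈e S∈e X∈d S∈d

  perspective-trans : ∀ {X a b c} → Perspective X a b → Perspective X b c → Perspective X a c
  perspective-trans a→b b→c Q Q∈a d X∈d Q∈d with a→b Q Q∈a d X∈d Q∈d
  ... | R , R∈d , R∈b = b→c R R∈b d X∈d R∈d

  fullPoint-sym : ∀ {b c P} → FullPoint U b c P → FullPoint U c b P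
  fullPoint-sym (P∉b , P∉c , persp) = P∉c , P∉b , perspective-sym P∉b P∉c persp

  ⊆F-swap : ∀ {a b c} → _⊆F[_,_] U a b c → _⊆F[_,_] U a c b
  ⊆F-swap a⊆Fbc P P∈a = fullPoint-sym (a⊆Fbc P P∈a)

  ⊆F-meet⇒⊆ : ∀ {a b c} → _⊆F[_,_] U a b c → Meets U b c → block b ⊆ block c
  ⊆F-meet⇒⊆ {a} {b} {c} a⊆Fbc (R , R∈b , R∈c) {Q} Q∈b with Q ∈? block c
  ... | yes Q∈c = Q∈c
  ... | no Q∉c with perspective-sym Q∉a Q∉c a→c R R∈c b Q∈b R∈b
    where
    Q∉a : Q ∉ block a
    Q∉a Q∈a = proj₁ (a⊆Fbc Q Q∈a) Q∈b
    a→c : Perspective Q a c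
    a→c P P∈a d Q∈d P∈d = proj₂ (proj₂ (a⊆Fbc P P∈a)) Q Q∈b d P∈d Q∈d
  ...   | P , P∈b , P∈a = ⊥-elim (proj₁ (a⊆Fbc P P∈a) P∈b)

  ⊆F⇒disjoint : ∀ {a b c} → b ≢ c → _⊆F[_,_] U a b c → Disjoint U b c
  ⊆F⇒disjoint b≢c a⊆Fbc R R∈b R∈c =
    b≢c (block-inj (⊆-antisym (⊆F-meet⇒⊆ a⊆Fbc (R , R∈b , R∈c))
                               (⊆F-meet⇒⊆ (⊆F-swap a⊆Fbc) (R , R∈c , R∈b))))

  ⊆F-rotate : ∀ {a b c} → a ≢ b → _⊆F[_,_] U c a b → _⊆F[_,_] U a b c
  ⊆F-rotate {a} {b} {c} a≢b c⊆Fab Q Q∈a = Q∉b , Q∉c , perspective-sym Q∉c Q∉b c→b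
    where
    Q∉b : Q ∉ block b
    Q∉b = ⊆F⇒disjoint a≢b c⊆Fab Q Q∈a
    Q∉c : Q ∉ block c
    Q∉c Q∈c = proj₁ (c⊆Fab Q Q∈c) Q∈a
    c→b : Perspective Q c b
    c→b P P∈c d Q∈d P∈d = proj₂ (proj₂ (c⊆Fab P P∈c)) Q Q∈a d P∈d Q∈d

  ⊆F-pivot : ∀ {x y a b} → x ≢ y → _⊆F[_,_] U a x y → _⊆F[_,_] U b x y → _⊆F[_,_] U x a b
  ⊆F-pivot x≢y a⊆Fxy b⊆Fxy Q Q∈x with ⊆F-rotate x≢y a⊆Fxy Q Q∈x | ⊆F-rotate x≢y b⊆Fxy Q Q∈x
  ... | full-ya | _ , Q∉b , y→b with fullPoint-sym full-ya
  ...   | Q∉a , _ , a→y = Q∉a , Q∉b , perspective-trans a→y y→b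

module DualNet {n : ℕ} (U : AbstractUnital n) {k : ℕ}
  (bs : Fin k → Block U) (bs-injective : Injective _≡_ _≡_ bs) where
  open AbstractUnital U
  open FullPoints U

  Full : Fin k → Fin k → Fin k → Set
  Full x y z = _⊆F[_,_] U (bs x) (bs y) (bs z)

  AllTriplesFull : Set
  AllTriplesFull = ∀ {x y z} → x ≢ y → y ≢ z → x ≢ z → Full x y z

  bs-≢ : ∀ {x y} → x ≢ y → bs x ≢ bs y
  bs-≢ x≢y bsx≡bsy = x≢y (bs-injective bsx≡bsy)

  Full-rotate : ∀ {x y z} → x ≢ y → Full z x y → Full x y z
  Full-rotate x≢y = ⊆F-rotate (bs-≢ x≢y)

  Full-pivot : ∀ {x y a b} → x ≢ y → Full a x y → Full b x y → Full x a b
  Full-pivot x≢y = ⊆F-pivot (bs-≢ x≢y)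

  allTriplesFull : ∀ {i₁ i₂} → i₁ ≢ i₂ → (∀ {w} → w ≢ i₁ → w ≢ i₂ → Full w i₁ i₂) →
    AllTriplesFull
  allTriplesFull {i₁} {i₂} i₁≢i₂ base = full
    where
    through-i₁ : ∀ {u v} → u ≢ v → u ≢ i₁ → v ≢ i₁ → Full i₁ u v
    through-i₁ {u} {v} u≢v u≢i₁ v≢i₁ with u ≟ i₂ | v ≟ i₂
    ... | yes refl | _ = Full-rotate i₁≢i₂ (base v≢i₁ (≢-sym u≢v))
    ... | _ | yes refl = ⊆F-swap (Full-rotate i₁≢i₂ (base u≢i₁ u≢v))
    ... | no u≢i₂ | no v≢i₂ = Full-pivot i₁≢i₂ (base u≢i₁ u≢i₂) (base v≢i₁ v≢i₂)

    avoiding-i₁ : ∀ {x y z} → x ≢ y → y ≢ z → x ≢ z → x ≢ i₁ → y ≢ i₁ → z ≢ i₁ → Full x y z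
    avoiding-i₁ x≢y y≢z x≢z x≢i₁ y≢i₁ z≢i₁ =
      Full-pivot x≢i₁ (Full-rotate (≢-sym x≢y) (through-i₁ (≢-sym x≢y) y≢i₁ x≢i₁))
                      (Full-rotate (≢-sym x≢z) (through-i₁ (≢-sym x≢z) z≢i₁ x≢i₁))

    full : AllTriplesFull
    full {x} {y} {z} x≢y y≢z x≢z with x ≟ i₁ | y ≟ i₁ | z ≟ i₁
    ... | yes refl | _ | _ = through-i₁ y≢z (≢-sym x≢y) (≢-sym x≢z)
    ... | _ | yes refl | _ =
      Full-rotate x≢y (Full-rotate (≢-sym x≢z) (through-i₁ (≢-sym x≢z) (≢-sym y≢z) x≢y))
    ... | _ | _ | yes refl = Full-rotate x≢y (through-i₁ x≢y x≢z y≢z)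
    ... | no x≢i₁ | no y≢i₁ | no z≢i₁ = avoiding-i₁ x≢y y≢z x≢z x≢i₁ y≢i₁ z≢i₁

  allTriplesFull⇒embeddedDualNet : ∀ {a b c} → a ≢ b → b ≢ c → a ≢ c →
    AllTriplesFull → EmbeddedDualNet U k bs
  allTriplesFull⇒embeddedDualNet a≢b b≢c a≢c full i j i<j = disjoint i≢j , meets-every-block-once
    where
    i≢j : i ≢ j
    i≢j i≡j = <-irrefl (cong toℕ i≡j) i<j

    disjoint : ∀ {i j} → i ≢ j → Disjoint U (bs i) (bs j)
    disjoint {i} {j} i≢j with avoid-two _≟_ a≢b b≢c a≢c i j
    ... | z , z≢i , z≢j = ⊆F⇒disjoint (bs-≢ i≢j) (full z≢i i≢j z≢j)

    not-both-on : ∀ {P Q} l → P ∈ block (bs i) → Q ∈ block (bs j) →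
      P ∈ block (bs l) → Q ∈ block (bs l) → ⊥
    not-both-on l P∈i Q∈j P∈l Q∈l with l ≟ i
    ... | yes refl = disjoint i≢j _ Q∈l Q∈j
    ... | no l≢i = disjoint (≢-sym l≢i) _ P∈i P∈l

    meets-every-block-once : ∀ P Q → P ∈ block (bs i) → Q ∈ block (bs j) →
      ∀ c → P ∈ block c → Q ∈ block c → ∀ l → MeetsInOnePoint U c (bs l)
    meets-every-block-once P Q P∈i Q∈j c P∈c Q∈c l =
      meetsInOnePoint (λ { refl → not-both-on l P∈i Q∈j P∈c Q∈c }) c-meets-l
      where
      c-meets-l : Meets U c (bs l)
      c-meets-l with l ≟ i | l ≟ j
      ... | yes refl | _ = P , P∈c , P∈i
      ... | _ | yes refl = Q , Q∈c , Q∈j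
      ... | no l≢i | no l≢j =
        proj₂ (proj₂ (full i≢j (≢-sym l≢j) (≢-sym l≢i) P P∈i)) Q Q∈j c P∈c Q∈c

  embeddedDualNet⇒Full : EmbeddedDualNet U k bs →
    ∀ {i j l} → toℕ i < toℕ l → toℕ j < toℕ l → Full l i j
  embeddedDualNet⇒Full net {i} {j} {l} i<l j<l P P∈l =
    (λ P∈i → proj₁ (net i l i<l) P P∈i P∈l) ,
    (λ P∈j → proj₁ (net j l j<l) P P∈j P∈l) ,
    i→j
    where
    i→j : Perspective P (bs i) (bs j)
    i→j Q Q∈i d P∈d Q∈d with proj₂ (net i l i<l) Q P Q∈i P∈l d Q∈d P∈d j
    ... | R , (R∈d , R∈j) , _ = R , R∈d , R∈j

toℕ-≢ : ∀ {k} {i j : Fin k} {a b : ℕ} → toℕ i ≡ a → toℕ j ≡ b → a ≢ b → i ≢ j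
toℕ-≢ refl refl a≢b i≡j = a≢b (cong toℕ i≡j)

lemma2p5 : ∀ {n} (U : AbstractUnital n) (k : ℕ) → 3 ≤ k →
    (bs : Fin k → Block U) → Injective _≡_ _≡_ bs →
    ∀ (i₁ i₂ i₃ : Fin k) → toℕ i₁ ≡ 0 → toℕ i₂ ≡ 1 → toℕ i₃ ≡ 2 →
    -- (i)
    (_⊆F[_,_] U (bs i₃) (bs i₁) (bs i₂) → Disjoint U (bs i₁) (bs i₂)) ×
    -- (ii)
    (_⊆F[_,_] U (bs i₃) (bs i₁) (bs i₂) →
      _⊆F[_,_] U (bs i₁) (bs i₂) (bs i₃) × _⊆F[_,_] U (bs i₂) (bs i₁) (bs i₃)) ×
    -- (iii) (meaningful when k ≥ 4; i₄ is the index of b₄)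
    (∀ (i₄ : Fin k) → toℕ i₄ ≡ 3 →
      _⊆F[_,_] U (bs i₃) (bs i₁) (bs i₂) → _⊆F[_,_] U (bs i₄) (bs i₁) (bs i₂) →
      Disjoint U (bs i₃) (bs i₄)) ×
    -- (iv)
    (EmbeddedDualNet U k bs ⇔
      (∀ (l : Fin k) → 2 ≤ toℕ l → _⊆F[_,_] U (bs l) (bs i₁) (bs i₂)))
lemma2p5 U k _ bs bs-injective i₁ i₂ i₃ i₁≡0 i₂≡1 i₃≡2 =
  (λ b₃⊆F → ⊆F⇒disjoint (bs-≢ i₁≢i₂) b₃⊆F) ,
  (λ b₃⊆F → Full-rotate i₁≢i₂ b₃⊆F , Full-rotate (≢-sym i₁≢i₂) (⊆F-swap b₃⊆F)) ,
  (λ i₄ i₄≡3 b₃⊆F b₄⊆F →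
    ⊆F⇒disjoint (bs-≢ (toℕ-≢ i₃≡2 i₄≡3 λ ())) (Full-pivot i₁≢i₂ b₃⊆F b₄⊆F)) ,
  mk⇔ (λ net l 2≤l → embeddedDualNet⇒Full net (<-≤-trans i₁<2 2≤l) (<-≤-trans i₂<2 2≤l))
      (λ full → allTriplesFull⇒embeddedDualNet i₁≢i₂ i₂≢i₃ i₁≢i₃
                  (allTriplesFull i₁≢i₂ (λ {w} w≢i₁ w≢i₂ → full w (2≤toℕ w≢i₁ w≢i₂))))
  where
  open FullPoints U
  open DualNet U bs bs-injective

  i₁≢i₂ : i₁ ≢ i₂
  i₁≢i₂ = toℕ-≢ i₁≡0 i₂≡1 λ ()
  i₂≢i₃ : i₂ ≢ i₃
  i₂≢i₃ = toℕ-≢ i₂≡1 i₃≡2 λ ()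
  i₁≢i₃ : i₁ ≢ i₃
  i₁≢i₃ = toℕ-≢ i₁≡0 i₃≡2 λ ()

  i₁<2 : toℕ i₁ < 2
  i₁<2 rewrite i₁≡0 = s≤s z≤n
  i₂<2 : toℕ i₂ < 2
  i₂<2 rewrite i₂≡1 = s≤s (s≤s z≤n)

  2≤toℕ : ∀ {w} → w ≢ i₁ → w ≢ i₂ → 2 ≤ toℕ w
  2≤toℕ {w} w≢i₁ w≢i₂ with toℕ w in toℕw≡
  ... | zero = ⊥-elim (w≢i₁ (toℕ-injective (trans toℕw≡ (sym i₁≡0))))
  ... | suc zero = ⊥-elim (w≢i₂ (toℕ-injective (trans toℕw≡ (sym i₂≡1))))
  ... | suc (suc _) = s≤s (s≤s z≤n)
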